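{- Let $n \ge 2$ be an integer and let $m=3n$. Let $\Gamma_{m}=\{z=(z_1,\dots,z_m)\in \mathbb{Z}_3^{m} : \sum_{i=1}^m z_i \equiv 0 \pmod 3\}$. For distinct $i,j\in\{1,\dots,m\}$ let $x_{i,j}\in\mathbb{Z}_3^m$ be the vector with $i$th coordinate $1$, $j$th coordinate $2$, and all other coordinates $0$, and let $X_m=\{x_{i,j}: 1\le i,j\le m,\ i\ne j\}$. Let $G_m$ be the graph with vertex set $\Gamma_m$ in which $y,z$ are adjacent iff $y-z\in X_m$. Then for every $y\in\Gamma_{3n}$, \[ d_{G_{3n}}(\mathbf{0},y) \le \frac{2\cdot(\text{number of nonzero coordinates of } y)}{3},\] and equality holds if and only if all nonzero coordinates of $y$ are identical.
   Context: $\mathbb{Z}_3^m$ is the additive group of $m$-tuples over $\mathbb{Z}_3=\{0,1,2\}$, $\mathbf{0}=(0,\dots,0)$, and $d_G(u,v)$ denotes graph distance in $G$. -}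

module Defs where

open import Data.Nat using (ℕ; zero; suc)
open import Data.Fin using (Fin; zero; suc; _≟_)
open import Data.Vec using (Vec; []; _∷_; lookup; tabulate; zipWith; replicate; foldr)
open import Data.Product using (Σ; ∃; _×_; _,_)
open import Relation.Binary.PropositionalEquality using (_≡_; _≢_)
open import Relation.Nullary using (yes; no)

ℤ₃ : Set
ℤ₃ = Fin 3

_⊕_ : ℤ₃ → ℤ₃ → ℤ₃
zero ⊕ b = b
suc zero ⊕ zero = suc zero
suc zero ⊕ suc zero = suc (suc zero)
suc zero ⊕ suc (suc zero) = zero
suc (suc zero) ⊕ zero = suc (suc zero)
suc (suc zero) ⊕ suc zero = zero
suc (suc zero) ⊕ suc (suc zero) = suc zero

⊖_ : ℤ₃ → ℤ₃
⊖ zero = zero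
⊖ suc zero = suc (suc zero)
⊖ suc (suc zero) = suc zero

Vec3 : ℕ → Set
Vec3 m = Vec ℤ₃ m

_-ᵥ_ : ∀ {m} → Vec3 m → Vec3 m → Vec3 m
y -ᵥ z = zipWith (λ a b → a ⊕ (⊖ b)) y z

𝟎 : ∀ {m} → Vec3 m
𝟎 = replicate _ zero

coordSum : ∀ {m} → Vec3 m → ℤ₃
coordSum = foldr _ _⊕_ zero

InΓ : ∀ {m} → Vec3 m → Set
InΓ z = coordSum z ≡ zero

xv : ∀ {m} → Fin m → Fin m → Vec3 m
xv i j = tabulate λ k → f k
  where
  f : _ → ℤ₃
  f k with k ≟ i
  ... | yes _ = suc zero
  ... | no _ with k ≟ j
  ...   | yes _ = suc (suc zero)
  ...   | no _ = zero

InX : ∀ {m} → Vec3 m → Set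
InX {m} v = Σ (Fin m) λ i → Σ (Fin m) λ j → i ≢ j × v ≡ xv i j

Adj : ∀ {m} → Vec3 m → Vec3 m → Set
Adj y z = InΓ y × InΓ z × InX (y -ᵥ z)

data Walk {m : ℕ} : Vec3 m → Vec3 m → ℕ → Set where
  stay : ∀ {u} → InΓ u → Walk u u 0
  step : ∀ {u v w k} → Walk u v k → Adj v w → Walk u w (suc k)

IsDist : ∀ {m} → Vec3 m → Vec3 m → ℕ → Set
IsDist u v d = Walk u v d × (∀ k → Walk u v k → d Data.Nat.≤ k)

weight : ∀ {m} → Vec3 m → ℕ
weight [] = zero
weight (zero ∷ v) = weight v
weight (suc _ ∷ v) = suc (weight v)

AllNonzeroSame : ∀ {m} → Vec3 m → Set
AllNonzeroSame {m} y = (i j : Fin m) → lookup y i ≢ zero → lookup y j ≢ zero → lookup y i ≡ lookup y j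

-- Let a and b be the numbers of coordinates of y equal to 1 and to 2.  The
-- potentials a + 2b = Σ y_k and 2a + b = Σ (−y_k), with coordinates read in
-- {0,1,2} ⊆ ℕ, each change by at most 3 along an edge, since every x_{i,j}
-- contributes exactly 3 to both; hence 3·d(0,y) ≥ max(a + 2b, 2a + b).
-- Conversely a greedy walk attains this: cancel a 1 against a 2, or, when only
-- one nonzero symbol occurs (at least three times, as y ∈ Γ), turn two copies
-- of it into one copy of the other symbol; either move lowers the maximum by
-- exactly 3.  Finally max(a + 2b, 2a + b) ≤ 2(a + b), with equality iff a = 0
-- or b = 0.
module Submission where

open import Defs
open import Data.Bool.Base using (if_then_else_)
open import Data.Empty using (⊥-elim)
open import Data.Fin using (Fin; zero; suc; toℕ; _≟_)
import Data.Fin.Properties as Fin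
open import Data.Nat using (ℕ; zero; suc; _+_; _*_; _≤_; _<_; _⊔_; z≤n; s≤s)
open import Data.Nat.Induction using (<-wellFounded)
open import Data.Nat.Properties hiding (_≟_)
open import Algebra.Properties.CommutativeSemigroup +-commutativeSemigroup
  using (x∙yz≈y∙xz; interchange)
open import Data.Nat.Tactic.RingSolver using (solve-∀)
open import Data.Product using (Σ; _×_; _,_; proj₁)
open import Data.Sum using (_⊎_; inj₁; inj₂)
open import Data.Vec using (Vec; []; _∷_; lookup; map; sum; zipWith; _[_]≔_)
open import Data.Vec.Properties
  using (lookup∘update; lookup∘update′; lookup-replicate; lookup-map; map-[]≔;
         lookup∘tabulate; tabulate∘lookup; tabulate-cong)
open import Function using (_∘_; _∋_)
open import Function.Bundles using (_⇔_; mk⇔)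
import Function.Properties.Equivalence as ⇔
open import Induction.WellFounded using (Acc; acc)
open import Relation.Binary.PropositionalEquality
open import Relation.Nullary using (yes; no; does)
open import Relation.Nullary.Decidable using (toWitness)

𝟙 𝟚 : ℤ₃
𝟙 = suc zero
𝟚 = suc (suc zero)

⊕-identityʳ : ∀ a → a ⊕ zero ≡ a
⊕-identityʳ zero = refl
⊕-identityʳ (suc zero) = refl
⊕-identityʳ (suc (suc zero)) = refl

⊕-inverseʳ : ∀ a → a ⊕ (⊖ a) ≡ zero
⊕-inverseʳ zero = refl
⊕-inverseʳ (suc zero) = refl
⊕-inverseʳ (suc (suc zero)) = refl

⊖-interchange : ∀ a b c d → (a ⊕ (⊖ b)) ⊕ (c ⊕ (⊖ d)) ≡ (a ⊕ c) ⊕ (⊖ (b ⊕ d))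
⊖-interchange = toWitness {a? = Fin.all? λ a → Fin.all? λ b → Fin.all? λ c → Fin.all? λ d →
  ((a ⊕ (⊖ b)) ⊕ (c ⊕ (⊖ d))) ≟ ((a ⊕ c) ⊕ (⊖ (b ⊕ d)))} _

toℕ-lipschitz : ∀ x y → toℕ y ≤ toℕ x + toℕ (⊖ (x ⊕ (⊖ y)))
toℕ-lipschitz = toWitness {a? = Fin.all? λ x → Fin.all? λ y →
  toℕ y ≤? toℕ x + toℕ (⊖ (x ⊕ (⊖ y)))} _

toℕ∘⊖-lipschitz : ∀ x y → toℕ (⊖ y) ≤ toℕ (⊖ x) + toℕ (x ⊕ (⊖ y))
toℕ∘⊖-lipschitz = toWitness {a? = Fin.all? λ x → Fin.all? λ y →
  toℕ (⊖ y) ≤? toℕ (⊖ x) + toℕ (x ⊕ (⊖ y))} _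

mod3 : ℕ → ℤ₃
mod3 zero = zero
mod3 (suc zero) = 𝟙
mod3 (suc (suc zero)) = 𝟚
mod3 (suc (suc (suc n))) = mod3 n

mod3-+ : ∀ x n → mod3 (toℕ x + n) ≡ x ⊕ mod3 n
mod3-+ zero n = refl
mod3-+ (suc zero) zero = refl
mod3-+ (suc zero) (suc zero) = refl
mod3-+ (suc zero) (suc (suc zero)) = refl
mod3-+ (suc zero) (suc (suc (suc n))) = mod3-+ 𝟙 n
mod3-+ (suc (suc zero)) zero = refl
mod3-+ (suc (suc zero)) (suc zero) = refl
mod3-+ (suc (suc zero)) (suc (suc zero)) = refl
mod3-+ (suc (suc zero)) (suc (suc (suc n))) = mod3-+ 𝟚 n

zipWith-[]≔ˡ : ∀ {A B C : Set} {m} (f : A → B → C) (xs : Vec A m) (ys : Vec B m) i x →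
  zipWith f (xs [ i ]≔ x) ys ≡ zipWith f xs ys [ i ]≔ f x (lookup ys i)
zipWith-[]≔ˡ f (x ∷ xs) (y ∷ ys) zero z = refl
zipWith-[]≔ˡ f (x ∷ xs) (y ∷ ys) (suc i) z = cong (f x y ∷_) (zipWith-[]≔ˡ f xs ys i z)

sum-[]≔ : ∀ {m} (xs : Vec ℕ m) i y → lookup xs i + sum (xs [ i ]≔ y) ≡ y + sum xs
sum-[]≔ (x ∷ xs) zero y = x∙yz≈y∙xz x y (sum xs)
sum-[]≔ (x ∷ xs) (suc i) y = begin
    lookup xs i + (x + sum (xs [ i ]≔ y))  ≡⟨ x∙yz≈y∙xz (lookup xs i) x _ ⟩
    x + (lookup xs i + sum (xs [ i ]≔ y))  ≡⟨ cong (x +_) (sum-[]≔ xs i y) ⟩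
    x + (y + sum xs)                       ≡⟨ x∙yz≈y∙xz x y (sum xs) ⟩
    y + (x + sum xs)                       ∎
  where open ≡-Reasoning

sum-map-[]≔₂ : ∀ {A : Set} {m} (f : A → ℕ) (v : Vec A m) {i j a b p q} → i ≢ j →
  lookup v i ≡ a → lookup v j ≡ b →
  f a + (f b + sum (map f ((v [ i ]≔ p) [ j ]≔ q))) ≡ f p + (f q + sum (map f v))
sum-map-[]≔₂ {m = m} f v {i} {j} {a} {b} {p} {q} i≢j vi vj = begin
    f a + (f b + sum (map f ((v [ i ]≔ p) [ j ]≔ q)))
  ≡⟨ cong (λ s → f a + (f b + sum s)) map-[]≔² ⟩
    f a + (f b + sum ((xs [ i ]≔ f p) [ j ]≔ f q))
  ≡⟨ cong (λ s → f a + (s + sum ((xs [ i ]≔ f p) [ j ]≔ f q))) fb ⟩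
    f a + (lookup (xs [ i ]≔ f p) j + sum ((xs [ i ]≔ f p) [ j ]≔ f q))
  ≡⟨ cong (f a +_) (sum-[]≔ (xs [ i ]≔ f p) j (f q)) ⟩
    f a + (f q + sum (xs [ i ]≔ f p))
  ≡⟨ x∙yz≈y∙xz (f a) (f q) _ ⟩
    f q + (f a + sum (xs [ i ]≔ f p))
  ≡⟨ cong (λ s → f q + (s + sum (xs [ i ]≔ f p))) fa ⟩
    f q + (lookup xs i + sum (xs [ i ]≔ f p))
  ≡⟨ cong (f q +_) (sum-[]≔ xs i (f p)) ⟩
    f q + (f p + sum xs)
  ≡⟨ x∙yz≈y∙xz (f q) (f p) (sum xs) ⟩
    f p + (f q + sum xs)
  ∎
  where
  open ≡-Reasoning
  xs : Vec ℕ m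
  xs = map f v
  map-[]≔² : map f ((v [ i ]≔ p) [ j ]≔ q) ≡ (xs [ i ]≔ f p) [ j ]≔ f q
  map-[]≔² = trans (map-[]≔ f (v [ i ]≔ p) j) (cong (_[ j ]≔ f q) (map-[]≔ f v i))
  fa : f a ≡ lookup xs i
  fa = sym (trans (lookup-map i f v) (cong f vi))
  fb : f b ≡ lookup (xs [ i ]≔ f p) j
  fb = sym (trans (lookup∘update′ (i≢j ∘ sym) xs (f p)) (trans (lookup-map j f v) (cong f vj)))

sum-map-𝟎 : ∀ (f : ℤ₃ → ℕ) → f zero ≡ 0 → ∀ m → sum (map f (𝟎 {m})) ≡ 0
sum-map-𝟎 f f0 zero = refl
sum-map-𝟎 f f0 (suc m) = cong₂ _+_ f0 (sum-map-𝟎 f f0 m)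

-ᵥ-self : ∀ {m} (v : Vec3 m) → v -ᵥ v ≡ 𝟎
-ᵥ-self [] = refl
-ᵥ-self (x ∷ v) = cong₂ _∷_ (⊕-inverseʳ x) (-ᵥ-self v)

xv-lookup : ∀ {m} {i j : Fin m} → i ≢ j → ∀ k →
  lookup (xv i j) k ≡ lookup ((𝟎 [ i ]≔ 𝟙) [ j ]≔ 𝟚) k
-- entry exposes the case split in the definition of xv, which the withs below evaluate.
xv-lookup {m} {i} {j} i≢j k with (lookup (xv i j) k ≡ _ ∋ lookup∘tabulate _ k)
... | entry with k ≟ i
...   | yes refl = trans entry (sym (begin
    lookup ((𝟎 [ k ]≔ 𝟙) [ j ]≔ 𝟚) k  ≡⟨ lookup∘update′ i≢j (𝟎 [ k ]≔ 𝟙) 𝟚 ⟩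
    lookup (𝟎 [ k ]≔ 𝟙) k            ≡⟨ lookup∘update k 𝟎 𝟙 ⟩
    𝟙                                ∎))
  where open ≡-Reasoning
...   | no k≢i with k ≟ j
...     | yes refl = trans entry (sym (lookup∘update k (𝟎 [ i ]≔ 𝟙) 𝟚))
...     | no k≢j = trans entry (sym (begin
    lookup ((𝟎 [ i ]≔ 𝟙) [ j ]≔ 𝟚) k  ≡⟨ lookup∘update′ k≢j (𝟎 [ i ]≔ 𝟙) 𝟚 ⟩
    lookup (𝟎 [ i ]≔ 𝟙) k            ≡⟨ lookup∘update′ k≢i 𝟎 𝟙 ⟩
    lookup (𝟎 {m}) k                 ≡⟨ lookup-replicate k zero ⟩
    zero                             ∎))
  where open ≡-Reasoning

xv≡[]≔ : ∀ {m} {i j : Fin m} → i ≢ j → xv i j ≡ (𝟎 [ i ]≔ 𝟙) [ j ]≔ 𝟚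
xv≡[]≔ i≢j = trans (sym (tabulate∘lookup _)) (trans (tabulate-cong (xv-lookup i≢j)) (tabulate∘lookup _))

sum-map-xv : ∀ (f : ℤ₃ → ℕ) → f zero ≡ 0 → ∀ {m} {i j : Fin m} → i ≢ j →
  sum (map f (xv i j)) ≡ f 𝟙 + f 𝟚
sum-map-xv f f0 {m} {i} {j} i≢j = begin
    sum (map f (xv i j))                ≡⟨ cong (sum ∘ map f) (xv≡[]≔ i≢j) ⟩
    sum (map f x)                       ≡⟨ cong₂ (λ s t → s + (t + sum (map f x))) f0 f0 ⟨
    f zero + (f zero + sum (map f x))   ≡⟨ sum-map-[]≔₂ f 𝟎 i≢j (lookup-replicate i zero) (lookup-replicate j zero) ⟩
    f 𝟙 + (f 𝟚 + sum (map f (𝟎 {m})))  ≡⟨ cong (λ s → f 𝟙 + (f 𝟚 + s)) (sum-map-𝟎 f f0 m) ⟩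
    f 𝟙 + (f 𝟚 + 0)                    ≡⟨ cong (f 𝟙 +_) (+-identityʳ (f 𝟚)) ⟩
    f 𝟙 + f 𝟚                          ∎
  where
  open ≡-Reasoning
  x : Vec3 m
  x = (𝟎 [ i ]≔ 𝟙) [ j ]≔ 𝟚

[]≔₂-difference : ∀ {m} (y : Vec3 m) {i j p q} → i ≢ j →
  p ⊕ (⊖ lookup y i) ≡ 𝟙 → q ⊕ (⊖ lookup y j) ≡ 𝟚 → ((y [ i ]≔ p) [ j ]≔ q) -ᵥ y ≡ xv i j
[]≔₂-difference y {i} {j} {p} {q} i≢j pᵢ qⱼ = begin
    ((y [ i ]≔ p) [ j ]≔ q) -ᵥ y
  ≡⟨ zipWith-[]≔ˡ _ (y [ i ]≔ p) y j q ⟩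
    ((y [ i ]≔ p) -ᵥ y) [ j ]≔ (q ⊕ (⊖ lookup y j))
  ≡⟨ cong (_[ j ]≔ (q ⊕ (⊖ lookup y j))) (zipWith-[]≔ˡ _ y y i p) ⟩
    ((y -ᵥ y) [ i ]≔ (p ⊕ (⊖ lookup y i))) [ j ]≔ (q ⊕ (⊖ lookup y j))
  ≡⟨ cong₂ (λ u s → (u [ i ]≔ s) [ j ]≔ (q ⊕ (⊖ lookup y j))) (-ᵥ-self y) pᵢ ⟩
    (𝟎 [ i ]≔ 𝟙) [ j ]≔ (q ⊕ (⊖ lookup y j))
  ≡⟨ cong ((𝟎 [ i ]≔ 𝟙) [ j ]≔_) qⱼ ⟩
    (𝟎 [ i ]≔ 𝟙) [ j ]≔ 𝟚
  ≡⟨ xv≡[]≔ i≢j ⟨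
    xv i j
  ∎
  where open ≡-Reasoning

δ : ℤ₃ → ℤ₃ → ℕ
δ x y = if does (x ≟ y) then 1 else 0

occurrences : ∀ {m} → ℤ₃ → Vec3 m → ℕ
occurrences x v = sum (map (δ x) v)

#𝟙 #𝟚 : ∀ {m} → Vec3 m → ℕ
#𝟙 = occurrences 𝟙
#𝟚 = occurrences 𝟚

position : ∀ {m} x (v : Vec3 m) {n} → occurrences x v ≡ suc n → Σ (Fin m) λ k → lookup v k ≡ x
position x (y ∷ v) e with x ≟ y
... | yes refl = zero , refl
... | no _ with position x v e
...   | k , vₖ = suc k , vₖ

two-positions : ∀ {m} x (v : Vec3 m) {n} → occurrences x v ≡ suc (suc n) →
  Σ (Fin m) λ j → Σ (Fin m) λ k → j ≢ k × lookup v j ≡ x × lookup v k ≡ x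
two-positions x (y ∷ v) e with x ≟ y
... | yes refl with position x v (suc-injective e)
...   | k , vₖ = zero , suc k , (λ ()) , refl , vₖ
two-positions x (y ∷ v) e | no _ with two-positions x v e
...   | j , k , j≢k , vⱼ , vₖ = suc j , suc k , j≢k ∘ Fin.suc-injective , vⱼ , vₖ

occurrences≡0⇒≢ : ∀ {m} x (v : Vec3 m) → occurrences x v ≡ 0 → ∀ k → lookup v k ≢ x
occurrences≡0⇒≢ x (y ∷ v) e k vₖ with x ≟ y
occurrences≡0⇒≢ x (y ∷ v) () k vₖ | yes _
occurrences≡0⇒≢ x (y ∷ v) e zero vₖ | no x≢y = x≢y (sym vₖ)
occurrences≡0⇒≢ x (y ∷ v) e (suc k) vₖ | no _ = occurrences≡0⇒≢ x v e k vₖ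

#𝟙≡0∧#𝟚≡0⇒≡𝟎 : ∀ {m} (v : Vec3 m) → #𝟙 v ≡ 0 → #𝟚 v ≡ 0 → v ≡ 𝟎
#𝟙≡0∧#𝟚≡0⇒≡𝟎 [] _ _ = refl
#𝟙≡0∧#𝟚≡0⇒≡𝟎 (zero ∷ v) e₁ e₂ = cong (zero ∷_) (#𝟙≡0∧#𝟚≡0⇒≡𝟎 v e₁ e₂)
#𝟙≡0∧#𝟚≡0⇒≡𝟎 (suc zero ∷ v) () _
#𝟙≡0∧#𝟚≡0⇒≡𝟎 (suc (suc zero) ∷ v) _ ()

weight≡#𝟙+#𝟚 : ∀ {m} (v : Vec3 m) → weight v ≡ #𝟙 v + #𝟚 v
weight≡#𝟙+#𝟚 [] = refl
weight≡#𝟙+#𝟚 (zero ∷ v) = weight≡#𝟙+#𝟚 v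
weight≡#𝟙+#𝟚 (suc zero ∷ v) = cong suc (weight≡#𝟙+#𝟚 v)
weight≡#𝟙+#𝟚 (suc (suc zero) ∷ v) = trans (cong suc (weight≡#𝟙+#𝟚 v)) (sym (+-suc (#𝟙 v) (#𝟚 v)))

sum-map-toℕ : ∀ {m} (v : Vec3 m) → sum (map toℕ v) ≡ #𝟙 v + 2 * #𝟚 v
sum-map-toℕ [] = refl
sum-map-toℕ (zero ∷ v) = sum-map-toℕ v
sum-map-toℕ (suc zero ∷ v) = cong suc (sum-map-toℕ v)
sum-map-toℕ (suc (suc zero) ∷ v) = trans (cong (2 +_) (sum-map-toℕ v)) (regroup (#𝟙 v) (#𝟚 v))
  where
  regroup : ∀ a b → 2 + (a + 2 * b) ≡ a + 2 * (1 + b)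
  regroup = solve-∀

sum-map-toℕ∘⊖ : ∀ {m} (v : Vec3 m) → sum (map (toℕ ∘ ⊖_) v) ≡ 2 * #𝟙 v + #𝟚 v
sum-map-toℕ∘⊖ [] = refl
sum-map-toℕ∘⊖ (zero ∷ v) = sum-map-toℕ∘⊖ v
sum-map-toℕ∘⊖ (suc zero ∷ v) = trans (cong (2 +_) (sum-map-toℕ∘⊖ v)) (regroup (#𝟙 v) (#𝟚 v))
  where
  regroup : ∀ a b → 2 + (2 * a + b) ≡ 2 * (1 + a) + b
  regroup = solve-∀
sum-map-toℕ∘⊖ (suc (suc zero) ∷ v) = trans (cong suc (sum-map-toℕ∘⊖ v)) (sym (+-suc _ (#𝟚 v)))

coordSum≡mod3 : ∀ {m} (v : Vec3 m) → coordSum v ≡ mod3 (sum (map toℕ v))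
coordSum≡mod3 [] = refl
coordSum≡mod3 (x ∷ v) = trans (cong (x ⊕_) (coordSum≡mod3 v)) (sym (mod3-+ x _))

coordSum-ᵥ : ∀ {m} (u v : Vec3 m) → coordSum (u -ᵥ v) ≡ coordSum u ⊕ (⊖ coordSum v)
coordSum-ᵥ [] [] = refl
coordSum-ᵥ (x ∷ u) (y ∷ v) =
  trans (cong ((x ⊕ (⊖ y)) ⊕_) (coordSum-ᵥ u v)) (⊖-interchange x y (coordSum u) (coordSum v))

InΓ⇒mod3 : ∀ {m} (v : Vec3 m) → InΓ v → mod3 (#𝟙 v + 2 * #𝟚 v) ≡ zero
InΓ⇒mod3 v γ = trans (cong mod3 (sym (sum-map-toℕ v))) (trans (sym (coordSum≡mod3 v)) γ)

InΓ-step : ∀ {m} {y y′ : Vec3 m} → InΓ y → InX (y′ -ᵥ y) → InΓ y′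
InΓ-step {y = y} {y′} γ (i , j , i≢j , y′-y≡x) = begin
    coordSum y′                    ≡⟨ ⊕-identityʳ (coordSum y′) ⟨
    coordSum y′ ⊕ (⊖ zero)           ≡⟨ cong (λ s → coordSum y′ ⊕ (⊖ s)) γ ⟨
    coordSum y′ ⊕ (⊖ coordSum y)     ≡⟨ coordSum-ᵥ y′ y ⟨
    coordSum (y′ -ᵥ y)             ≡⟨ cong coordSum y′-y≡x ⟩
    coordSum (xv i j)              ≡⟨ coordSum≡mod3 (xv i j) ⟩
    mod3 (sum (map toℕ (xv i j)))  ≡⟨ cong mod3 (sum-map-xv toℕ refl i≢j) ⟩
    zero                           ∎
  where open ≡-Reasoning

[]≔₂-adjacent : ∀ {m} {y : Vec3 m} {i j a b p q} → InΓ y → i ≢ j →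
  lookup y i ≡ a → lookup y j ≡ b → p ⊕ (⊖ a) ≡ 𝟙 → q ⊕ (⊖ b) ≡ 𝟚 → Adj ((y [ i ]≔ p) [ j ]≔ q) y
[]≔₂-adjacent {y = y} {i} {j} {p = p} {q} γ i≢j refl refl p⊖a q⊖b = InΓ-step γ edge , γ , edge
  where
  edge : InX (((y [ i ]≔ p) [ j ]≔ q) -ᵥ y)
  edge = i , j , i≢j , []≔₂-difference y i≢j p⊖a q⊖b


cost : ℕ → ℕ → ℕ
cost a b = (a + 2 * b) ⊔ (2 * a + b)

‖_‖ : ∀ {m} → Vec3 m → ℕ
‖ v ‖ = cost (#𝟙 v) (#𝟚 v)

cost-comm : ∀ a b → cost a b ≡ cost b a
cost-comm a b = trans (⊔-comm (a + 2 * b) (2 * a + b)) (cong₂ _⊔_ (+-comm (2 * a) b) (+-comm a (2 * b)))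

cost-suc-suc : ∀ a b → cost (suc a) (suc b) ≡ 3 + cost a b
cost-suc-suc a b = trans (cong₂ _⊔_ (shift₁ a b) (shift₂ a b)) (sym (+-distribˡ-⊔ 3 (a + 2 * b) (2 * a + b)))
  where
  shift₁ : ∀ a b → suc a + 2 * suc b ≡ 3 + (a + 2 * b)
  shift₁ = solve-∀
  shift₂ : ∀ a b → 2 * suc a + suc b ≡ 3 + (2 * a + b)
  shift₂ = solve-∀

cost-≥ : ∀ a b → b ≤ a → cost a b ≡ 2 * a + b
cost-≥ a b b≤a = m≤n⇒m⊔n≡n (begin
    a + 2 * b    ≡⟨ regroup₁ a b ⟩
    (a + b) + b  ≤⟨ +-monoʳ-≤ (a + b) b≤a ⟩
    (a + b) + a  ≡⟨ regroup₂ a b ⟩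
    2 * a + b    ∎)
  where
  open ≤-Reasoning
  regroup₁ : ∀ a b → a + 2 * b ≡ (a + b) + b
  regroup₁ = solve-∀
  regroup₂ : ∀ a b → (a + b) + a ≡ 2 * a + b
  regroup₂ = solve-∀

cost-merge : ∀ t → cost (3 + t) 0 ≡ 3 + cost (1 + t) 1
cost-merge t = begin
    cost (3 + t) 0          ≡⟨ cost-≥ (3 + t) 0 z≤n ⟩
    2 * (3 + t) + 0         ≡⟨ rearrange t ⟩
    3 + (2 * (1 + t) + 1)   ≡⟨ cong (3 +_) (cost-≥ (1 + t) 1 (s≤s z≤n)) ⟨
    3 + cost (1 + t) 1      ∎
  where
  open ≡-Reasoning
  rearrange : ∀ t → 2 * (3 + t) + 0 ≡ 3 + (2 * (1 + t) + 1)
  rearrange = solve-∀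

cost≤2*[a+b] : ∀ a b → cost a b ≤ 2 * (a + b)
cost≤2*[a+b] a b = ⊔-lub
  (≤-trans (m≤n+m (a + 2 * b) a) (≤-reflexive (regroup₁ a b)))
  (≤-trans (m≤m+n (2 * a + b) b) (≤-reflexive (regroup₂ a b)))
  where
  regroup₁ : ∀ a b → a + (a + 2 * b) ≡ 2 * (a + b)
  regroup₁ = solve-∀
  regroup₂ : ∀ a b → 2 * a + b + b ≡ 2 * (a + b)
  regroup₂ = solve-∀

cost≡2*[a+b]⇔ : ∀ a b → (cost a b ≡ 2 * (a + b)) ⇔ (a ≡ 0 ⊎ b ≡ 0)
cost≡2*[a+b]⇔ a b = mk⇔ (to a b) (from a b)
  where
  open ≤-Reasoning
  to : ∀ a b → cost a b ≡ 2 * (a + b) → a ≡ 0 ⊎ b ≡ 0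
  to zero b _ = inj₁ refl
  to (suc a) zero _ = inj₂ refl
  to (suc a) (suc b) eq = ⊥-elim (<-irrefl eq (begin-strict
    cost (suc a) (suc b)  ≡⟨ cost-suc-suc a b ⟩
    3 + cost a b          ≤⟨ +-monoʳ-≤ 3 (cost≤2*[a+b] a b) ⟩
    3 + 2 * (a + b)       <⟨ n<1+n _ ⟩
    4 + 2 * (a + b)       ≡⟨ regroup a b ⟩
    2 * (suc a + suc b)   ∎))
    where
    regroup : ∀ a b → 4 + 2 * (a + b) ≡ 2 * (suc a + suc b)
    regroup = solve-∀
  from : ∀ a b → a ≡ 0 ⊎ b ≡ 0 → cost a b ≡ 2 * (a + b)
  from a b (inj₁ refl) = trans (cost-comm 0 b) (trans (cost-≥ b 0 z≤n) (+-identityʳ (2 * b)))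
  from a b (inj₂ refl) = trans (cost-≥ a 0 z≤n) (trans (+-identityʳ (2 * a)) (cong (2 *_) (sym (+-identityʳ a))))

-- Lower bound

sum-map-lipschitz : ∀ (f g : ℤ₃ → ℕ) → (∀ x y → f y ≤ f x + g (x ⊕ (⊖ y))) →
  ∀ {m} (v w : Vec3 m) → sum (map f w) ≤ sum (map f v) + sum (map g (v -ᵥ w))
sum-map-lipschitz f g lip [] [] = z≤n
sum-map-lipschitz f g lip (x ∷ v) (y ∷ w) = begin
    f y + sum (map f w)
  ≤⟨ +-mono-≤ (lip x y) (sum-map-lipschitz f g lip v w) ⟩
    (f x + g (x ⊕ (⊖ y))) + (sum (map f v) + sum (map g (v -ᵥ w)))
  ≡⟨ interchange (f x) _ _ _ ⟩
    (f x + sum (map f v)) + (g (x ⊕ (⊖ y)) + sum (map g (v -ᵥ w)))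
  ∎
  where open ≤-Reasoning

sum-map-walk : ∀ (f g : ℤ₃ → ℕ) → (∀ x y → f y ≤ f x + g (x ⊕ (⊖ y))) → g zero ≡ 0 →
  ∀ {m} {u v : Vec3 m} {k} → Walk u v k → sum (map f v) ≤ sum (map f u) + k * (g 𝟙 + g 𝟚)
sum-map-walk f g lip g0 (stay _) = m≤m+n _ 0
sum-map-walk f g lip g0 {u = u} (step {v = v} {w} {k} walk (_ , _ , i , j , i≢j , v-w≡x)) = begin
    sum (map f w)
  ≤⟨ sum-map-lipschitz f g lip v w ⟩
    sum (map f v) + sum (map g (v -ᵥ w))
  ≡⟨ cong (sum (map f v) +_) (trans (cong (sum ∘ map g) v-w≡x) (sum-map-xv g g0 i≢j)) ⟩
    sum (map f v) + c
  ≤⟨ +-monoˡ-≤ c (sum-map-walk f g lip g0 walk) ⟩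
    sum (map f u) + k * c + c
  ≡⟨ +-assoc (sum (map f u)) (k * c) c ⟩
    sum (map f u) + (k * c + c)
  ≡⟨ cong (sum (map f u) +_) (+-comm (k * c) c) ⟩
    sum (map f u) + suc k * c
  ∎
  where
  open ≤-Reasoning
  c : ℕ
  c = g 𝟙 + g 𝟚

‖‖≤3*length : ∀ {m} {v : Vec3 m} {k} → Walk 𝟎 v k → ‖ v ‖ ≤ 3 * k
‖‖≤3*length {m} {v} {k} walk = ⊔-lub
  (subst (_≤ 3 * k) (sum-map-toℕ v) (potential toℕ (toℕ ∘ ⊖_) toℕ-lipschitz refl refl refl))
  (subst (_≤ 3 * k) (sum-map-toℕ∘⊖ v) (potential (toℕ ∘ ⊖_) toℕ toℕ∘⊖-lipschitz refl refl refl))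
  where
  open ≤-Reasoning
  potential : ∀ f g → (∀ x y → f y ≤ f x + g (x ⊕ (⊖ y))) → f zero ≡ 0 → g zero ≡ 0 → g 𝟙 + g 𝟚 ≡ 3 →
    sum (map f v) ≤ 3 * k
  potential f g lip f0 g0 g3 = begin
    sum (map f v)                          ≤⟨ sum-map-walk f g lip g0 walk ⟩
    sum (map f (𝟎 {m})) + k * (g 𝟙 + g 𝟚)  ≡⟨ cong₂ (λ s c → s + k * c) (sum-map-𝟎 f f0 m) g3 ⟩
    k * 3                                  ≡⟨ *-comm k 3 ⟩
    3 * k                                  ∎

-- Upper bound

Predecessor : ∀ {m} → Vec3 m → Set
Predecessor {m} y = Σ (Vec3 m) λ y′ → Adj y′ y × ‖ y ‖ ≡ 3 + ‖ y′ ‖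

cancel-pair : ∀ {m} (y : Vec3 m) {a b} → InΓ y → #𝟙 y ≡ suc a → #𝟚 y ≡ suc b → Predecessor y
cancel-pair {m} y γ ones twos with position 𝟚 y twos | position 𝟙 y ones
... | i , yᵢ | j , yⱼ = y′ , []≔₂-adjacent γ i≢j yᵢ yⱼ refl refl , (begin
    cost (#𝟙 y) (#𝟚 y)                ≡⟨ cong₂ cost ones′ twos′ ⟨
    cost (suc (#𝟙 y′)) (suc (#𝟚 y′))  ≡⟨ cost-suc-suc (#𝟙 y′) (#𝟚 y′) ⟩
    3 + ‖ y′ ‖                        ∎)
  where
  open ≡-Reasoning
  i≢j : i ≢ j
  i≢j refl = (𝟚 ≢ 𝟙 ∋ λ ()) (trans (sym yᵢ) yⱼ)
  y′ : Vec3 m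
  y′ = (y [ i ]≔ zero) [ j ]≔ zero
  ones′ : suc (#𝟙 y′) ≡ #𝟙 y
  ones′ = sum-map-[]≔₂ (δ 𝟙) y i≢j yᵢ yⱼ
  twos′ : suc (#𝟚 y′) ≡ #𝟚 y
  twos′ = sum-map-[]≔₂ (δ 𝟚) y i≢j yᵢ yⱼ

merge-ones : ∀ {m} (y : Vec3 m) {a} → InΓ y → #𝟙 y ≡ 3 + a → #𝟚 y ≡ 0 → Predecessor y
merge-ones {m} y {a} γ ones twos with two-positions 𝟙 y ones
... | j , k , j≢k , yⱼ , yₖ = y′ , []≔₂-adjacent γ j≢k yⱼ yₖ refl refl , (begin
    cost (#𝟙 y) (#𝟚 y)    ≡⟨ cong₂ cost ones twos ⟩
    cost (3 + a) 0        ≡⟨ cost-merge a ⟩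
    3 + cost (1 + a) 1    ≡⟨ cong₂ (λ o t → 3 + cost o t) ones′ twos′ ⟨
    3 + ‖ y′ ‖            ∎)
  where
  open ≡-Reasoning
  y′ : Vec3 m
  y′ = (y [ j ]≔ 𝟚) [ k ]≔ zero
  ones′ : #𝟙 y′ ≡ 1 + a
  ones′ = suc-injective (suc-injective (trans (sum-map-[]≔₂ (δ 𝟙) y j≢k yⱼ yₖ) ones))
  twos′ : #𝟚 y′ ≡ 1
  twos′ = trans (sum-map-[]≔₂ (δ 𝟚) y j≢k yⱼ yₖ) (cong suc twos)

merge-twos : ∀ {m} (y : Vec3 m) {b} → InΓ y → #𝟙 y ≡ 0 → #𝟚 y ≡ 3 + b → Predecessor y
merge-twos {m} y {b} γ ones twos with two-positions 𝟚 y twos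
... | j , k , j≢k , yⱼ , yₖ = y′ , []≔₂-adjacent γ j≢k yⱼ yₖ refl refl , (begin
    cost (#𝟙 y) (#𝟚 y)    ≡⟨ cong₂ cost ones twos ⟩
    cost 0 (3 + b)        ≡⟨ cost-comm 0 (3 + b) ⟩
    cost (3 + b) 0        ≡⟨ cost-merge b ⟩
    3 + cost (1 + b) 1    ≡⟨ cong (3 +_) (cost-comm (1 + b) 1) ⟩
    3 + cost 1 (1 + b)    ≡⟨ cong₂ (λ o t → 3 + cost o t) ones′ twos′ ⟨
    3 + ‖ y′ ‖            ∎)
  where
  open ≡-Reasoning
  y′ : Vec3 m
  y′ = (y [ j ]≔ zero) [ k ]≔ 𝟙
  ones′ : #𝟙 y′ ≡ 1
  ones′ = trans (sum-map-[]≔₂ (δ 𝟙) y j≢k yⱼ yₖ) (cong suc ones)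
  twos′ : #𝟚 y′ ≡ 1 + b
  twos′ = suc-injective (suc-injective (trans (sum-map-[]≔₂ (δ 𝟚) y j≢k yⱼ yₖ) twos))

descend : ∀ {m} (y : Vec3 m) → InΓ y → y ≡ 𝟎 ⊎ Predecessor y
descend y γ = by-counts (#𝟙 y) (#𝟚 y) refl refl (InΓ⇒mod3 y γ)
  where
  by-counts : ∀ a b → #𝟙 y ≡ a → #𝟚 y ≡ b → mod3 (a + 2 * b) ≡ zero → y ≡ 𝟎 ⊎ Predecessor y
  by-counts zero zero ones twos _ = inj₁ (#𝟙≡0∧#𝟚≡0⇒≡𝟎 y ones twos)
  by-counts (suc _) (suc _) ones twos _ = inj₂ (cancel-pair y γ ones twos)
  by-counts (suc (suc (suc _))) zero ones twos _ = inj₂ (merge-ones y γ ones twos)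
  by-counts zero (suc (suc (suc _))) ones twos _ = inj₂ (merge-twos y γ ones twos)
  by-counts (suc zero) zero _ _ ()
  by-counts (suc (suc zero)) zero _ _ ()
  by-counts zero (suc zero) _ _ ()
  by-counts zero (suc (suc zero)) _ _ ()

‖𝟎‖≡0 : ∀ m → ‖ 𝟎 {m} ‖ ≡ 0
‖𝟎‖≡0 m = cong₂ cost (sum-map-𝟎 (δ 𝟙) refl m) (sum-map-𝟎 (δ 𝟚) refl m)

geodesic : ∀ {m} (y : Vec3 m) → InΓ y → Σ ℕ λ d → Walk 𝟎 y d × 3 * d ≡ ‖ y ‖
geodesic y γ = build y γ (<-wellFounded ‖ y ‖)
  where
  build : ∀ {m} (y : Vec3 m) → InΓ y → Acc _<_ ‖ y ‖ → Σ ℕ λ d → Walk 𝟎 y d × 3 * d ≡ ‖ y ‖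
  build {m} y γ (acc smaller) with descend y γ
  ... | inj₁ refl = 0 , stay γ , sym (‖𝟎‖≡0 m)
  ... | inj₂ (y′ , adj , ‖y‖≡) with build y′ (proj₁ adj) (smaller (subst (‖ y′ ‖ <_) (sym ‖y‖≡) (s≤s (m≤n+m _ 2))))
  ...   | d , walk , 3d≡ = suc d , step walk adj , trans (*-suc 3 d) (trans (cong (3 +_) 3d≡) (sym ‖y‖≡))

-- The equality case

≢zero∧≢⇒≡⊖ : ∀ {x t : ℤ₃} → x ≢ zero → t ≢ zero → x ≢ t → x ≡ ⊖ t
≢zero∧≢⇒≡⊖ {zero} x≢0 _ _ = ⊥-elim (x≢0 refl)
≢zero∧≢⇒≡⊖ {t = zero} _ t≢0 _ = ⊥-elim (t≢0 refl)
≢zero∧≢⇒≡⊖ {suc zero} {suc zero} _ _ x≢t = ⊥-elim (x≢t refl)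
≢zero∧≢⇒≡⊖ {suc zero} {suc (suc zero)} _ _ _ = refl
≢zero∧≢⇒≡⊖ {suc (suc zero)} {suc zero} _ _ _ = refl
≢zero∧≢⇒≡⊖ {suc (suc zero)} {suc (suc zero)} _ _ x≢t = ⊥-elim (x≢t refl)

allNonzeroSame⇔ : ∀ {m} (y : Vec3 m) → AllNonzeroSame y ⇔ (#𝟙 y ≡ 0 ⊎ #𝟚 y ≡ 0)
allNonzeroSame⇔ y = mk⇔ to from
  where
  nonzero : ∀ {a : ℤ₃} {x : Fin 2} → a ≡ suc x → a ≢ zero
  nonzero refl ()
  to : AllNonzeroSame y → #𝟙 y ≡ 0 ⊎ #𝟚 y ≡ 0
  to same with #𝟙 y in ones | #𝟚 y in twos
  ... | zero | _ = inj₁ refl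
  ... | suc _ | zero = inj₂ refl
  ... | suc _ | suc _ with position 𝟙 y ones | position 𝟚 y twos
  ...   | i , yᵢ | j , yⱼ =
    ⊥-elim ((𝟙 ≢ 𝟚 ∋ λ ()) (trans (sym yᵢ) (trans (same i j (nonzero yᵢ) (nonzero yⱼ)) yⱼ)))
  avoiding : ∀ t → t ≢ zero → occurrences t y ≡ 0 → AllNonzeroSame y
  avoiding t t≢0 none i j yᵢ≢0 yⱼ≢0 =
    trans (≢zero∧≢⇒≡⊖ yᵢ≢0 t≢0 (occurrences≡0⇒≢ t y none i))
          (sym (≢zero∧≢⇒≡⊖ yⱼ≢0 t≢0 (occurrences≡0⇒≢ t y none j)))
  from : #𝟙 y ≡ 0 ⊎ #𝟚 y ≡ 0 → AllNonzeroSame y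
  from (inj₁ none) = avoiding 𝟙 (λ ()) none
  from (inj₂ none) = avoiding 𝟚 (λ ()) none

‖‖≤2*weight : ∀ {m} (y : Vec3 m) → ‖ y ‖ ≤ 2 * weight y
‖‖≤2*weight y = subst (λ w → ‖ y ‖ ≤ 2 * w) (sym (weight≡#𝟙+#𝟚 y)) (cost≤2*[a+b] (#𝟙 y) (#𝟚 y))

‖‖≡2*weight⇔ : ∀ {m} (y : Vec3 m) → (‖ y ‖ ≡ 2 * weight y) ⇔ AllNonzeroSame y
‖‖≡2*weight⇔ y = subst (λ w → (‖ y ‖ ≡ 2 * w) ⇔ AllNonzeroSame y) (sym (weight≡#𝟙+#𝟚 y))
  (⇔.trans (cost≡2*[a+b]⇔ (#𝟙 y) (#𝟚 y)) (⇔.sym (allNonzeroSame⇔ y)))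

lemma2 : (n : ℕ) → 2 ≤ n → (y : Vec3 (3 * n)) → InΓ y →
    Σ ℕ λ d → IsDist 𝟎 y d × (3 * d ≤ 2 * weight y)
      × ((3 * d ≡ 2 * weight y) ⇔ AllNonzeroSame y)
lemma2 _ _ y γ with geodesic y γ
... | d , walk , 3d≡‖y‖ =
  d , (walk , shortest) , subst (_≤ 2 * weight y) (sym 3d≡‖y‖) (‖‖≤2*weight y)
    , subst (λ s → (s ≡ 2 * weight y) ⇔ AllNonzeroSame y) (sym 3d≡‖y‖) (‖‖≡2*weight⇔ y)
  where
  shortest : ∀ k → Walk 𝟎 y k → d ≤ k
  shortest k walk′ = *-cancelˡ-≤ 3 (subst (_≤ 3 * k) (sym 3d≡‖y‖) (‖‖≤3*length walk′))
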